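{- The substitution rule $(sub)$: from $\mathcal{G}$ infer $\mathcal{G}[b/a]$ (where $a,b$ are parameters and $\mathcal{G}[b/a]$ replaces every occurrence of $a$ in $\mathcal{G}$ by $b$), is height-preserving admissible in $\mathsf{LNIF}$: whenever $\mathcal{G}$ has an $\mathsf{LNIF}$-derivation of height $h$, $\mathcal{G}[b/a]$ has an $\mathsf{LNIF}$-derivation of height at most $h$.
   Context: The height of a derivation is the number of sequents on its longest branch from the end sequent to an initial sequent. Formulae are first-order over $\bot,\land,\lor,\supset,\forall,\exists$; in sequents bound variables $x,y,\dots$ are distinct from parameters $a,b,\dots$, which occupy all free positions; $A[a/x]$ replaces free occurrences of $x$ by $a$; $p(\vec a)$ is an atomic formula with parameters $\vec a$. A linear nested sequent is $\Gamma_1\vdash\Delta_1 /\!/ \cdots /\!/ \Gamma_n\vdash\Delta_n$ ($n\ge1$), each $\Gamma_i,\Delta_i$ a finite, possibly empty, multiset of formulae (a component). In rule schemas, $\mathcal{G},\mathcal{H},\mathcal{F}$ denote possibly empty sequences of components. $\mathsf{LNIF}$ has the rules (from premise(s) infer conclusion): Initial: $(id_1)$ $\mathcal{G}/\!/\Gamma,p(\vec a)\vdash p(\vec a),\Delta/\!/\mathcal{H}$; $(id_2)$ $\mathcal{G}/\!/\Gamma_1,p(\vec a)\vdash\Delta_1/\!/\mathcal{H}/\!/\Gamma_2\vdash p(\vec a),\Delta_2/\!/\mathcal{F}$; $(\bot_l)$ $\mathcal{G}/\!/\Gamma,\bot\vdash\Delta/\!/\mathcal{H}$. $(\land_l)$: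 from $\mathcal{G}/\!/\Gamma,A,B\vdash\Delta/\!/\mathcal{H}$ infer $\mathcal{G}/\!/\Gamma,A\land B\vdash\Delta/\!/\mathcal{H}$. $(\lor_r)$: from $\mathcal{G}/\!/\Gamma\vdash\Delta,A,B/\!/\mathcal{H}$ infer $\mathcal{G}/\!/\Gamma\vdash\Delta,A\lor B/\!/\mathcal{H}$. $(\land_r)$: from $\mathcal{G}/\!/\Gamma\vdash\Delta,A/\!/\mathcal{H}$ and $\mathcal{G}/\!/\Gamma\vdash\Delta,B/\!/\mathcal{H}$ infer $\mathcal{G}/\!/\Gamma\vdash\Delta,A\land B/\!/\mathcal{H}$. $(\lor_l)$: from $\mathcal{G}/\!/\Gamma,A\vdash\Delta/\!/\mathcal{H}$ and $\mathcal{G}/\!/\Gamma,B\vdash\Delta/\!/\mathcal{H}$ infer $\mathcal{G}/\!/\Gamma,A\lor B\vdash\Delta/\!/\mathcal{H}$. $(\supset_{r1})$: from $\mathcal{G}/\!/\Gamma\vdash\Delta/\!/A\vdash B$ infer $\mathcal{G}/\!/\Gamma\vdash\Delta,A\supset B$. $(\supset_l)$: from $\mathcal{G}/\!/\Gamma,B\vdash\Delta/\!/\mathcal{H}$ and $\mathcal{G}/\!/\Gamma,A\supset B\vdash A,\Delta/\!/\mathcal{H}$ infer $\mathcal{G}/\!/\Gamma,A\supset B\vdash\Delta/\!/\mathcal{H}$. $(lift)$: from $\mathcal{G}/\!/\Gamma_1,A\vdash\Delta_1/\!/\Gamma_2,A\vdash\Delta_2/\!/\mathcal{H}$ infer $\mathcal{G}/\!/\Gamma_1,A\vdash\Delta_1/\!/\Gamma_2\vdash\Delta_2/\!/\mathcal{H}$.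 $(\forall_l)$: from $\mathcal{G}/\!/\Gamma,A[a/x],\forall xA\vdash\Delta/\!/\mathcal{H}$ infer $\mathcal{G}/\!/\Gamma,\forall xA\vdash\Delta/\!/\mathcal{H}$ ($a$ any parameter). $(\forall_{r1})$: from $\mathcal{G}/\!/\Gamma\vdash\Delta/\!/\ \vdash A[a/x]$ infer $\mathcal{G}/\!/\Gamma\vdash\Delta,\forall xA$. $(\exists_l)$: from $\mathcal{G}/\!/\Gamma,A[a/x]\vdash\Delta/\!/\mathcal{H}$ infer $\mathcal{G}/\!/\Gamma,\exists xA\vdash\Delta/\!/\mathcal{H}$. $(\exists_r)$: from $\mathcal{G}/\!/\Gamma\vdash A[a/x],\exists xA,\Delta/\!/\mathcal{H}$ infer $\mathcal{G}/\!/\Gamma\vdash\exists xA,\Delta/\!/\mathcal{H}$ ($a$ any parameter). $(\supset_{r2})$: from $\mathcal{G}/\!/\Gamma_1\vdash\Delta_1/\!/A\vdash B/\!/\Gamma_2\vdash\Delta_2/\!/\mathcal{H}$ and $\mathcal{G}/\!/\Gamma_1\vdash\Delta_1/\!/\Gamma_2\vdash\Delta_2,A\supset B/\!/\mathcal{H}$ infer $\mathcal{G}/\!/\Gamma_1\vdash\Delta_1,A\supset B/\!/\Gamma_2\vdash\Delta_2/\!/\mathcal{H}$. $(\forall_{r2})$: from $\mathcal{G}/\!/\Gamma_1\vdash\Delta_1/\!/\ \vdash A[a/x]/\!/\Gamma_2\vdash\Delta_2/\!/\mathcal{H}$ and $\mathcal{G}/\!/\Gamma_1\vdash\Delta_1/\!/\Gamma_2\vdash\Delta_2,\forall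 xA/\!/\mathcal{H}$ infer $\mathcal{G}/\!/\Gamma_1\vdash\Delta_1,\forall xA/\!/\Gamma_2\vdash\Delta_2/\!/\mathcal{H}$. In $(\forall_{r1}),(\exists_l),(\forall_{r2})$, $a$ is an eigenvariable (does not occur in the conclusion). -}

module Defs where

open import Data.Nat using (ℕ; suc; _⊔_; _≟_)
open import Data.List using (List; []; _∷_; _++_; [_]; map; concatMap)
open import Data.List.Relation.Unary.All using (All)
open import Data.List.Membership.Propositional using (_∈_; _∉_)
open import Data.List.Relation.Binary.Permutation.Propositional using (_↭_)
open import Data.List.Relation.Binary.Pointwise using (Pointwise)
open import Data.Product using (_×_; _,_)
open import Data.Unit using (⊤)
open import Relation.Nullary using (yes; no)

-- There are no
-- function symbols: an atom p(t₁,…,tₙ) has terms that are variables or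
-- parameters (in sequents only parameters occur free).

data Tm : Set where
  var : ℕ → Tm
  par : ℕ → Tm

infixr 8 _∧'_
infixr 7 _∨'_
infixr 6 _⊃_

data Fm : Set where
  atom : ℕ → List Tm → Fm
  ⊥'   : Fm
  _∧'_ _∨'_ _⊃_ : Fm → Fm → Fm
  ∀' ∃' : ℕ → Fm → Fm

instTm : ℕ → ℕ → Tm → Tm
instTm x a (var y) with x ≟ y
... | yes _ = par a
... | no  _ = var y
instTm x a (par c) = par c

inst : Fm → ℕ → ℕ → Fm     -- inst A x a  =  A[a/x]
inst (atom p ts) x a = atom p (map (instTm x a) ts)
inst ⊥' x a = ⊥'
inst (A ∧' B) x a = inst A x a ∧' inst B x a
inst (A ∨' B) x a = inst A x a ∨' inst B x a
inst (A ⊃ B) x a = inst A x a ⊃ inst B x a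
inst (∀' y A) x a with x ≟ y
... | yes _ = ∀' y A
... | no  _ = ∀' y (inst A x a)
inst (∃' y A) x a with x ≟ y
... | yes _ = ∃' y A
... | no  _ = ∃' y (inst A x a)

substTm : ℕ → ℕ → Tm → Tm
substTm a b (var y) = var y
substTm a b (par c) with a ≟ c
... | yes _ = par b
... | no  _ = par c

substF : ℕ → ℕ → Fm → Fm
substF a b (atom p ts) = atom p (map (substTm a b) ts)
substF a b ⊥' = ⊥'
substF a b (A ∧' B) = substF a b A ∧' substF a b B
substF a b (A ∨' B) = substF a b A ∨' substF a b B
substF a b (A ⊃ B) = substF a b A ⊃ substF a b B
substF a b (∀' y A) = ∀' y (substF a b A)
substF a b (∃' y A) = ∃' y (substF a b A)

parsTm : Tm → List ℕ
parsTm (var _) = []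
parsTm (par c) = [ c ]

parsF : Fm → List ℕ
parsF (atom p ts) = concatMap parsTm ts
parsF ⊥' = []
parsF (A ∧' B) = parsF A ++ parsF B
parsF (A ∨' B) = parsF A ++ parsF B
parsF (A ⊃ B) = parsF A ++ parsF B
parsF (∀' y A) = parsF A
parsF (∃' y A) = parsF A

ClosedTm : List ℕ → Tm → Set
ClosedTm bs (var y) = y ∈ bs
ClosedTm bs (par _) = ⊤

ClosedIn : List ℕ → Fm → Set
ClosedIn bs (atom p ts) = All (ClosedTm bs) ts
ClosedIn bs ⊥' = ⊤
ClosedIn bs (A ∧' B) = ClosedIn bs A × ClosedIn bs B
ClosedIn bs (A ∨' B) = ClosedIn bs A × ClosedIn bs B
ClosedIn bs (A ⊃ B) = ClosedIn bs A × ClosedIn bs B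
ClosedIn bs (∀' y A) = ClosedIn (y ∷ bs) A
ClosedIn bs (∃' y A) = ClosedIn (y ∷ bs) A

Closed : Fm → Set
Closed = ClosedIn []

-- Linear nested sequents.  A component Γ ⊢ Δ is a pair of lists read as
-- multisets; a linear nested sequent is a list of components
-- (derivable ones always have n ≥ 1 components).

Comp : Set
Comp = List Fm × List Fm

LNS : Set
LNS = List Comp

_⊢_ : List Fm → List Fm → Comp
Γ ⊢ Δ = Γ , Δ
infix 4 _⊢_

_≈c_ : Comp → Comp → Set
(Γ , Δ) ≈c (Γ' , Δ') = (Γ ↭ Γ') × (Δ ↭ Δ')

_≈_ : LNS → LNS → Set
_≈_ = Pointwise _≈c_

substC : ℕ → ℕ → Comp → Comp
substC a b (Γ , Δ) = map (substF a b) Γ , map (substF a b) Δ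

substS : ℕ → ℕ → LNS → LNS
substS a b = map (substC a b)

parsC : Comp → List ℕ
parsC (Γ , Δ) = concatMap parsF Γ ++ concatMap parsF Δ

parsS : LNS → List ℕ
parsS = concatMap parsC

ClosedS : LNS → Set
ClosedS G = All (λ c → All Closed (Data.Product.proj₁ c) × All Closed (Data.Product.proj₂ c)) G

-- LNIF derivations.  Each rule's conclusion is any sequent G that is
-- (componentwise multiset-)equal to the schema instance; premises are
-- the schema instances.

data Der : LNS → Set where
  id₁ : ∀ {S} G H Γ Δ p as →
        S ≈ (G ++ (atom p (map par as) ∷ Γ ⊢ atom p (map par as) ∷ Δ) ∷ H) → Der S
  id₂ : ∀ {S} G H F Γ₁ Δ₁ Γ₂ Δ₂ p as →
        S ≈ (G ++ (atom p (map par as) ∷ Γ₁ ⊢ Δ₁) ∷ H ++ (Γ₂ ⊢ atom p (map par as) ∷ Δ₂) ∷ F) → Der S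
  ⊥l  : ∀ {S} G H Γ Δ →
        S ≈ (G ++ (⊥' ∷ Γ ⊢ Δ) ∷ H) → Der S
  ∧l  : ∀ {S} G H Γ Δ A B →
        S ≈ (G ++ (A ∧' B ∷ Γ ⊢ Δ) ∷ H) →
        Der (G ++ (A ∷ B ∷ Γ ⊢ Δ) ∷ H) → Der S
  ∨r  : ∀ {S} G H Γ Δ A B →
        S ≈ (G ++ (Γ ⊢ A ∨' B ∷ Δ) ∷ H) →
        Der (G ++ (Γ ⊢ A ∷ B ∷ Δ) ∷ H) → Der S
  ∧r  : ∀ {S} G H Γ Δ A B →
        S ≈ (G ++ (Γ ⊢ A ∧' B ∷ Δ) ∷ H) →
        Der (G ++ (Γ ⊢ A ∷ Δ) ∷ H) → Der (G ++ (Γ ⊢ B ∷ Δ) ∷ H) → Der S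
  ∨l  : ∀ {S} G H Γ Δ A B →
        S ≈ (G ++ (A ∨' B ∷ Γ ⊢ Δ) ∷ H) →
        Der (G ++ (A ∷ Γ ⊢ Δ) ∷ H) → Der (G ++ (B ∷ Γ ⊢ Δ) ∷ H) → Der S
  ⊃r₁ : ∀ {S} G Γ Δ A B →
        S ≈ (G ++ [ Γ ⊢ A ⊃ B ∷ Δ ]) →
        Der (G ++ (Γ ⊢ Δ) ∷ [ [ A ] ⊢ [ B ] ]) → Der S
  ⊃l  : ∀ {S} G H Γ Δ A B →
        S ≈ (G ++ (A ⊃ B ∷ Γ ⊢ Δ) ∷ H) →
        Der (G ++ (B ∷ Γ ⊢ Δ) ∷ H) → Der (G ++ (A ⊃ B ∷ Γ ⊢ A ∷ Δ) ∷ H) → Der S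
  lift : ∀ {S} G H Γ₁ Δ₁ Γ₂ Δ₂ A →
        S ≈ (G ++ (A ∷ Γ₁ ⊢ Δ₁) ∷ (Γ₂ ⊢ Δ₂) ∷ H) →
        Der (G ++ (A ∷ Γ₁ ⊢ Δ₁) ∷ (A ∷ Γ₂ ⊢ Δ₂) ∷ H) → Der S
  ∀l  : ∀ {S} G H Γ Δ x A a →
        S ≈ (G ++ (∀' x A ∷ Γ ⊢ Δ) ∷ H) →
        Der (G ++ (inst A x a ∷ ∀' x A ∷ Γ ⊢ Δ) ∷ H) → Der S
  ∀r₁ : ∀ {S} G Γ Δ x A a →
        S ≈ (G ++ [ Γ ⊢ ∀' x A ∷ Δ ]) →
        a ∉ parsS S →
        Der (G ++ (Γ ⊢ Δ) ∷ [ [] ⊢ [ inst A x a ] ]) → Der S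
  ∃l  : ∀ {S} G H Γ Δ x A a →
        S ≈ (G ++ (∃' x A ∷ Γ ⊢ Δ) ∷ H) →
        a ∉ parsS S →
        Der (G ++ (inst A x a ∷ Γ ⊢ Δ) ∷ H) → Der S
  ∃r  : ∀ {S} G H Γ Δ x A a →
        S ≈ (G ++ (Γ ⊢ ∃' x A ∷ Δ) ∷ H) →
        Der (G ++ (Γ ⊢ inst A x a ∷ ∃' x A ∷ Δ) ∷ H) → Der S
  ⊃r₂ : ∀ {S} G H Γ₁ Δ₁ Γ₂ Δ₂ A B →
        S ≈ (G ++ (Γ₁ ⊢ A ⊃ B ∷ Δ₁) ∷ (Γ₂ ⊢ Δ₂) ∷ H) →
        Der (G ++ (Γ₁ ⊢ Δ₁) ∷ ([ A ] ⊢ [ B ]) ∷ (Γ₂ ⊢ Δ₂) ∷ H) →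
        Der (G ++ (Γ₁ ⊢ Δ₁) ∷ (Γ₂ ⊢ A ⊃ B ∷ Δ₂) ∷ H) → Der S
  ∀r₂ : ∀ {S} G H Γ₁ Δ₁ Γ₂ Δ₂ x A a →
        S ≈ (G ++ (Γ₁ ⊢ ∀' x A ∷ Δ₁) ∷ (Γ₂ ⊢ Δ₂) ∷ H) →
        a ∉ parsS S →
        Der (G ++ (Γ₁ ⊢ Δ₁) ∷ ([] ⊢ [ inst A x a ]) ∷ (Γ₂ ⊢ Δ₂) ∷ H) →
        Der (G ++ (Γ₁ ⊢ Δ₁) ∷ (Γ₂ ⊢ ∀' x A ∷ Δ₂) ∷ H) → Der S

height : ∀ {S} → Der S → ℕ
height (id₁ _ _ _ _ _ _ _) = 1
height (id₂ _ _ _ _ _ _ _ _ _ _) = 1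
height (⊥l _ _ _ _ _) = 1
height (∧l _ _ _ _ _ _ _ d) = suc (height d)
height (∨r _ _ _ _ _ _ _ d) = suc (height d)
height (∧r _ _ _ _ _ _ _ d e) = suc (height d ⊔ height e)
height (∨l _ _ _ _ _ _ _ d e) = suc (height d ⊔ height e)
height (⊃r₁ _ _ _ _ _ _ d) = suc (height d)
height (⊃l _ _ _ _ _ _ _ d e) = suc (height d ⊔ height e)
height (lift _ _ _ _ _ _ _ _ d) = suc (height d)
height (∀l _ _ _ _ _ _ _ _ d) = suc (height d)
height (∀r₁ _ _ _ _ _ _ _ _ d) = suc (height d)
height (∃l _ _ _ _ _ _ _ _ _ d) = suc (height d)
height (∃r _ _ _ _ _ _ _ _ d) = suc (height d)
height (⊃r₂ _ _ _ _ _ _ _ _ _ d e) = suc (height d ⊔ height e)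
height (∀r₂ _ _ _ _ _ _ _ _ _ _ _ d e) = suc (height d ⊔ height e)

-- [b/a] is the renaming of parameters that sends a to b, and any renaming σ
-- acts on derivations rule by rule without changing the height, since every
-- rule schema is stable under renaming.  The one obstacle is an eigenvariable
-- c, which σ may identify with a parameter of the conclusion; there the
-- premises are renamed by σ [ c ≔ c' ] with c' fresh for the renamed
-- conclusion, a renaming that agrees with σ on the conclusion because c does
-- not occur in it.

module Submission where

open import Defs
open import Function using (_∘_)
open import Data.Nat using (ℕ; _≤_; suc; _⊔_; _≟_)
open import Data.Nat.Properties using (≤-reflexive; 1+n≰n)
open import Data.Product using (Σ; _,_)
open import Data.List using (List; []; _∷_; _++_; [_]; map; concatMap)
open import Data.List.Properties using (map-++; map-∘; map-cong)
open import Data.List.Extrema.Nat using (max; xs≤max)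
open import Data.List.Membership.Propositional using (_∈_; _∉_)
open import Data.List.Membership.Propositional.Properties using (∈-++⁺ˡ; ∈-++⁺ʳ)
open import Data.List.Relation.Unary.All as All using ()
open import Data.List.Relation.Unary.Any using (here)
open import Data.List.Relation.Binary.Permutation.Propositional
  using (_↭_; refl; prep; swap; trans; ↭-sym)
open import Data.List.Relation.Binary.Permutation.Propositional.Properties
  using (map⁺; ++⁺; ++⁺ˡ; shifts; ∈-resp-↭)
open import Data.List.Relation.Binary.Pointwise using ([]; _∷_)
open import Relation.Binary.PropositionalEquality
  using (_≡_; _≢_; refl; sym; cong; cong₂; subst; _≗_)
  renaming (trans to ≡-trans)
open import Relation.Nullary using (yes; no)
open import Data.Empty using (⊥-elim)

Renaming : Set
Renaming = ℕ → ℕ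

renTm : Renaming → Tm → Tm
renTm σ (var y) = var y
renTm σ (par c) = par (σ c)

renF : Renaming → Fm → Fm
renF σ (atom p ts) = atom p (map (renTm σ) ts)
renF σ ⊥' = ⊥'
renF σ (A ∧' B) = renF σ A ∧' renF σ B
renF σ (A ∨' B) = renF σ A ∨' renF σ B
renF σ (A ⊃ B) = renF σ A ⊃ renF σ B
renF σ (∀' y A) = ∀' y (renF σ A)
renF σ (∃' y A) = ∃' y (renF σ A)

renC : Renaming → Comp → Comp
renC σ (Γ , Δ) = map (renF σ) Γ , map (renF σ) Δ

renS : Renaming → LNS → LNS
renS σ = map (renC σ)

replace : ℕ → ℕ → Renaming
replace a b c with a ≟ c
... | yes _ = b
... | no  _ = c

substTm≗renTm : ∀ a b → substTm a b ≗ renTm (replace a b)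
substTm≗renTm a b (var y) = refl
substTm≗renTm a b (par c) with a ≟ c
... | yes _ = refl
... | no  _ = refl

substF≗renF : ∀ a b → substF a b ≗ renF (replace a b)
substF≗renF a b (atom p ts) = cong (atom p) (map-cong (substTm≗renTm a b) ts)
substF≗renF a b ⊥' = refl
substF≗renF a b (A ∧' B) = cong₂ _∧'_ (substF≗renF a b A) (substF≗renF a b B)
substF≗renF a b (A ∨' B) = cong₂ _∨'_ (substF≗renF a b A) (substF≗renF a b B)
substF≗renF a b (A ⊃ B) = cong₂ _⊃_ (substF≗renF a b A) (substF≗renF a b B)
substF≗renF a b (∀' y A) = cong (∀' y) (substF≗renF a b A)
substF≗renF a b (∃' y A) = cong (∃' y) (substF≗renF a b A)

substC≗renC : ∀ a b → substC a b ≗ renC (replace a b)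
substC≗renC a b (Γ , Δ) =
  cong₂ _,_ (map-cong (substF≗renF a b) Γ) (map-cong (substF≗renF a b) Δ)

substS≗renS : ∀ a b → substS a b ≗ renS (replace a b)
substS≗renS a b = map-cong (substC≗renC a b)

renTm-instTm : ∀ σ x c → renTm σ ∘ instTm x c ≗ instTm x (σ c) ∘ renTm σ
renTm-instTm σ x c (var y) with x ≟ y
... | yes _ = refl
... | no  _ = refl
renTm-instTm σ x c (par d) = refl

renF-inst : ∀ σ x c A → renF σ (inst A x c) ≡ inst (renF σ A) x (σ c)
renF-inst σ x c (atom p ts) =
  cong (atom p)
    (≡-trans (sym (map-∘ ts)) (≡-trans (map-cong (renTm-instTm σ x c) ts) (map-∘ ts)))
renF-inst σ x c ⊥' = refl
renF-inst σ x c (A ∧' B) = cong₂ _∧'_ (renF-inst σ x c A) (renF-inst σ x c B)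
renF-inst σ x c (A ∨' B) = cong₂ _∨'_ (renF-inst σ x c A) (renF-inst σ x c B)
renF-inst σ x c (A ⊃ B) = cong₂ _⊃_ (renF-inst σ x c A) (renF-inst σ x c B)
renF-inst σ x c (∀' y A) with x ≟ y
... | yes _ = refl
... | no  _ = cong (∀' y) (renF-inst σ x c A)
renF-inst σ x c (∃' y A) with x ≟ y
... | yes _ = refl
... | no  _ = cong (∃' y) (renF-inst σ x c A)

renF-atom : ∀ σ p as → renF σ (atom p (map par as)) ≡ atom p (map par (map σ as))
renF-atom σ p as = cong (atom p) (≡-trans (sym (map-∘ as)) (map-∘ as))

_≗_on_ : Renaming → Renaming → List ℕ → Set
σ ≗ τ on ps = ∀ {p} → p ∈ ps → σ p ≡ τ p

map-cong-on : ∀ {A B : Set} (P : A → List ℕ) {σ τ} {f g : A → B} →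
              (∀ x → σ ≗ τ on P x → f x ≡ g x) →
              ∀ xs → σ ≗ τ on concatMap P xs → map f xs ≡ map g xs
map-cong-on P f≡g [] σ≗τ = refl
map-cong-on P f≡g (x ∷ xs) σ≗τ =
  cong₂ _∷_ (f≡g x (σ≗τ ∘ ∈-++⁺ˡ))
            (map-cong-on P f≡g xs (σ≗τ ∘ ∈-++⁺ʳ (P x)))

renTm-cong : ∀ {σ τ} t → σ ≗ τ on parsTm t → renTm σ t ≡ renTm τ t
renTm-cong (var y) σ≗τ = refl
renTm-cong (par c) σ≗τ = cong par (σ≗τ (here refl))

renF-cong : ∀ {σ τ} A → σ ≗ τ on parsF A → renF σ A ≡ renF τ A
renF-cong (atom p ts) σ≗τ = cong (atom p) (map-cong-on parsTm renTm-cong ts σ≗τ)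
renF-cong ⊥' σ≗τ = refl
renF-cong (A ∧' B) σ≗τ =
  cong₂ _∧'_ (renF-cong A (σ≗τ ∘ ∈-++⁺ˡ))
             (renF-cong B (σ≗τ ∘ ∈-++⁺ʳ (parsF A)))
renF-cong (A ∨' B) σ≗τ =
  cong₂ _∨'_ (renF-cong A (σ≗τ ∘ ∈-++⁺ˡ))
             (renF-cong B (σ≗τ ∘ ∈-++⁺ʳ (parsF A)))
renF-cong (A ⊃ B) σ≗τ =
  cong₂ _⊃_ (renF-cong A (σ≗τ ∘ ∈-++⁺ˡ))
            (renF-cong B (σ≗τ ∘ ∈-++⁺ʳ (parsF A)))
renF-cong (∀' y A) σ≗τ = cong (∀' y) (renF-cong A σ≗τ)
renF-cong (∃' y A) σ≗τ = cong (∃' y) (renF-cong A σ≗τ)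

renC-cong : ∀ {σ τ} C → σ ≗ τ on parsC C → renC σ C ≡ renC τ C
renC-cong (Γ , Δ) σ≗τ =
  cong₂ _,_ (map-cong-on parsF renF-cong Γ (σ≗τ ∘ ∈-++⁺ˡ))
            (map-cong-on parsF renF-cong Δ (σ≗τ ∘ ∈-++⁺ʳ (concatMap parsF Γ)))

renS-cong : ∀ {σ τ} S → σ ≗ τ on parsS S → renS σ S ≡ renS τ S
renS-cong = map-cong-on parsC renC-cong

concatMap-↭ : ∀ {A B : Set} (f : A → List B) {xs ys} →
              xs ↭ ys → concatMap f xs ↭ concatMap f ys
concatMap-↭ f refl = refl
concatMap-↭ f (prep x xs↭ys) = ++⁺ˡ (f x) (concatMap-↭ f xs↭ys)
concatMap-↭ f (swap x y xs↭ys) =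
  trans (shifts (f x) (f y)) (++⁺ˡ (f y) (++⁺ˡ (f x) (concatMap-↭ f xs↭ys)))
concatMap-↭ f (trans xs↭ys ys↭zs) = trans (concatMap-↭ f xs↭ys) (concatMap-↭ f ys↭zs)

parsS-↭ : ∀ {S T} → S ≈ T → parsS S ↭ parsS T
parsS-↭ [] = refl
parsS-↭ ((Γ↭ , Δ↭) ∷ S≈T) =
  ++⁺ (++⁺ (concatMap-↭ parsF Γ↭) (concatMap-↭ parsF Δ↭)) (parsS-↭ S≈T)

renS-resp-≈ : ∀ σ {S T} → S ≈ T → renS σ S ≈ renS σ T
renS-resp-≈ σ [] = []
renS-resp-≈ σ ((Γ↭ , Δ↭) ∷ S≈T) =
  (map⁺ (renF σ) Γ↭ , map⁺ (renF σ) Δ↭) ∷ renS-resp-≈ σ S≈T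

fresh : List ℕ → ℕ
fresh ps = suc (max 0 ps)

fresh∉ : ∀ ps → fresh ps ∉ ps
fresh∉ ps fresh∈ps = 1+n≰n (All.lookup (xs≤max 0 ps) fresh∈ps)

_[_≔_] : Renaming → ℕ → ℕ → Renaming
(σ [ c ≔ c' ]) p with c ≟ p
... | yes _ = c'
... | no  _ = σ p

[≔]-self : ∀ σ c c' → (σ [ c ≔ c' ]) c ≡ c'
[≔]-self σ c c' with c ≟ c
... | yes _ = refl
... | no c≢c = ⊥-elim (c≢c refl)

[≔]-other : ∀ σ {c} c' {p} → c ≢ p → (σ [ c ≔ c' ]) p ≡ σ p
[≔]-other σ {c} c' {p} c≢p with c ≟ p
... | yes c≡p = ⊥-elim (c≢p c≡p)
... | no  _ = refl

renS-[≔]-∉ : ∀ σ {c} c' S → c ∉ parsS S → renS (σ [ c ≔ c' ]) S ≡ renS σ S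
renS-[≔]-∉ σ c' S c∉S =
  renS-cong S (λ p∈S → [≔]-other σ c' (λ c≡p → c∉S (subst (_∈ parsS S) (sym c≡p) p∈S)))

DerOfHeight : LNS → ℕ → Set
DerOfHeight S n = Σ (Der S) (λ d → height d ≡ n)

DerOfHeight-subst : ∀ {S T n} → S ≡ T → DerOfHeight S n → DerOfHeight T n
DerOfHeight-subst refl d = d

renS-++ : ∀ σ G X H → renS σ (G ++ X ∷ H) ≡ renS σ G ++ renC σ X ∷ renS σ H
renS-++ σ G X H = map-++ (renC σ) G (X ∷ H)

rename-conclusion : ∀ σ G {S X H K} → S ≈ (G ++ X ∷ H) → renS σ (X ∷ H) ≡ K →
                    renS σ S ≈ (renS σ G ++ K)
rename-conclusion σ G {X = X} {H = H} S≈ refl =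
  subst (_ ≈_) (renS-++ σ G X H) (renS-resp-≈ σ S≈)

rename-conclusion-[≔] : ∀ σ {c} c' G {S X H K} → S ≈ (G ++ X ∷ H) → c ∉ parsS S →
                        renS (σ [ c ≔ c' ]) (X ∷ H) ≡ K →
                        renS σ S ≈ (renS (σ [ c ≔ c' ]) G ++ K)
rename-conclusion-[≔] σ {c} c' G {X = X} {H = H} S≈ c∉S refl =
  subst (_ ≈_) (≡-trans (sym (renS-[≔]-∉ σ c' (G ++ X ∷ H) c∉T))
                        (renS-++ (σ [ c ≔ c' ]) G X H))
        (renS-resp-≈ σ S≈)
  where c∉T = c∉S ∘ ∈-resp-↭ (↭-sym (parsS-↭ S≈))

renF-inst-[≔] : ∀ σ c c' x A →
                renF (σ [ c ≔ c' ]) (inst A x c) ≡ inst (renF (σ [ c ≔ c' ]) A) x c'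
renF-inst-[≔] σ c c' x A =
  ≡-trans (renF-inst (σ [ c ≔ c' ]) x c A)
          (cong (inst (renF (σ [ c ≔ c' ]) A) x) ([≔]-self σ c c'))

mutual
  Der-rename : ∀ σ {S} (d : Der S) → DerOfHeight (renS σ S) (height d)
  Der-rename σ (id₁ G H Γ Δ p as S≈) =
    id₁ (renS σ G) (renS σ H) _ _ p (map σ as)
      (rename-conclusion σ G S≈
        (cong (λ P → (P ∷ map (renF σ) Γ , P ∷ map (renF σ) Δ) ∷ renS σ H)
              (renF-atom σ p as)))
    , refl
  Der-rename σ (id₂ G H F Γ₁ Δ₁ Γ₂ Δ₂ p as S≈) =
    id₂ (renS σ G) (renS σ H) (renS σ F) _ _ _ _ p (map σ as)
      (rename-conclusion σ G S≈ (≡-trans (cong (_ ∷_) (renS-++ σ H _ F))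
        (cong (λ P → (P ∷ map (renF σ) Γ₁ , map (renF σ) Δ₁) ∷ renS σ H
                       ++ (map (renF σ) Γ₂ , P ∷ map (renF σ) Δ₂) ∷ renS σ F)
              (renF-atom σ p as))))
    , refl
  Der-rename σ (⊥l G H Γ Δ S≈) =
    ⊥l (renS σ G) (renS σ H) _ _ (rename-conclusion σ G S≈ refl) , refl
  Der-rename σ (∧l G H Γ Δ A B S≈ d) =
    let d' , h = rename-premise σ G refl d
    in ∧l (renS σ G) (renS σ H) _ _ _ _ (rename-conclusion σ G S≈ refl) d' , cong suc h
  Der-rename σ (∨r G H Γ Δ A B S≈ d) =
    let d' , h = rename-premise σ G refl d
    in ∨r (renS σ G) (renS σ H) _ _ _ _ (rename-conclusion σ G S≈ refl) d' , cong suc h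
  Der-rename σ (∧r G H Γ Δ A B S≈ d e) =
    let d' , h = rename-premise σ G refl d
        e' , k = rename-premise σ G refl e
    in ∧r (renS σ G) (renS σ H) _ _ _ _ (rename-conclusion σ G S≈ refl) d' e'
       , cong suc (cong₂ _⊔_ h k)
  Der-rename σ (∨l G H Γ Δ A B S≈ d e) =
    let d' , h = rename-premise σ G refl d
        e' , k = rename-premise σ G refl e
    in ∨l (renS σ G) (renS σ H) _ _ _ _ (rename-conclusion σ G S≈ refl) d' e'
       , cong suc (cong₂ _⊔_ h k)
  Der-rename σ (⊃r₁ G Γ Δ A B S≈ d) =
    let d' , h = rename-premise σ G refl d
    in ⊃r₁ (renS σ G) _ _ _ _ (rename-conclusion σ G S≈ refl) d' , cong suc h
  Der-rename σ (⊃l G H Γ Δ A B S≈ d e) =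
    let d' , h = rename-premise σ G refl d
        e' , k = rename-premise σ G refl e
    in ⊃l (renS σ G) (renS σ H) _ _ _ _ (rename-conclusion σ G S≈ refl) d' e'
       , cong suc (cong₂ _⊔_ h k)
  Der-rename σ (lift G H Γ₁ Δ₁ Γ₂ Δ₂ A S≈ d) =
    let d' , h = rename-premise σ G refl d
    in lift (renS σ G) (renS σ H) _ _ _ _ _ (rename-conclusion σ G S≈ refl) d' , cong suc h
  Der-rename σ (∀l G H Γ Δ x A a S≈ d) =
    let d' , h = rename-premise σ G (cong (λ B → (B ∷ _ , _) ∷ _) (renF-inst σ x a A)) d
    in ∀l (renS σ G) (renS σ H) _ _ x _ (σ a) (rename-conclusion σ G S≈ refl) d' , cong suc h
  Der-rename σ (∃r G H Γ Δ x A a S≈ d) =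
    let d' , h = rename-premise σ G (cong (λ B → (_ , B ∷ _) ∷ _) (renF-inst σ x a A)) d
    in ∃r (renS σ G) (renS σ H) _ _ x _ (σ a) (rename-conclusion σ G S≈ refl) d' , cong suc h
  Der-rename σ {S} (∀r₁ G Γ Δ x A c S≈ c∉S d) =
    let c' = fresh (parsS (renS σ S))
        τ = σ [ c ≔ c' ]
        d' , h = rename-premise τ G
                   (cong (λ B → _ ∷ [ _ , [ B ] ]) (renF-inst-[≔] σ c c' x A)) d
    in ∀r₁ (renS τ G) _ _ x _ c' (rename-conclusion-[≔] σ c' G S≈ c∉S refl)
           (fresh∉ (parsS (renS σ S))) d'
       , cong suc h
  Der-rename σ {S} (∃l G H Γ Δ x A c S≈ c∉S d) =
    let c' = fresh (parsS (renS σ S))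
        τ = σ [ c ≔ c' ]
        d' , h = rename-premise τ G
                   (cong (λ B → (B ∷ _ , _) ∷ _) (renF-inst-[≔] σ c c' x A)) d
    in ∃l (renS τ G) (renS τ H) _ _ x _ c' (rename-conclusion-[≔] σ c' G S≈ c∉S refl)
          (fresh∉ (parsS (renS σ S))) d'
       , cong suc h
  Der-rename σ (⊃r₂ G H Γ₁ Δ₁ Γ₂ Δ₂ A B S≈ d e) =
    let d' , h = rename-premise σ G refl d
        e' , k = rename-premise σ G refl e
    in ⊃r₂ (renS σ G) (renS σ H) _ _ _ _ _ _ (rename-conclusion σ G S≈ refl) d' e'
       , cong suc (cong₂ _⊔_ h k)
  Der-rename σ {S} (∀r₂ G H Γ₁ Δ₁ Γ₂ Δ₂ x A c S≈ c∉S d e) =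
    let c' = fresh (parsS (renS σ S))
        τ = σ [ c ≔ c' ]
        d' , h = rename-premise τ G
                   (cong (λ B → _ ∷ (_ , [ B ]) ∷ _) (renF-inst-[≔] σ c c' x A)) d
        e' , k = rename-premise τ G refl e
    in ∀r₂ (renS τ G) (renS τ H) _ _ _ _ x _ c' (rename-conclusion-[≔] σ c' G S≈ c∉S refl)
           (fresh∉ (parsS (renS σ S))) d' e'
       , cong suc (cong₂ _⊔_ h k)

  rename-premise : ∀ σ G {X H K} → renS σ (X ∷ H) ≡ K → (d : Der (G ++ X ∷ H)) →
                   DerOfHeight (renS σ G ++ K) (height d)
  rename-premise σ G {X} {H} refl d = DerOfHeight-subst (renS-++ σ G X H) (Der-rename σ d)

lemma4 : (a b : ℕ) (G : LNS) → ClosedS G → (d : Der G) →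
         Σ (Der (substS a b G)) (λ d' → height d' ≤ height d)
lemma4 a b G _ d =
  let d' , h = DerOfHeight-subst (sym (substS≗renS a b G)) (Der-rename (replace a b) d)
  in d' , ≤-reflexive h
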